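{- For every $n\geq 1$, $c_{n,1}(q)=G_{2n}(q)$.
   Context: For $m\in\mathbb Z$, $r\in\mathbb N$: $(x;q)_r=(1-x)(1-xq)\cdots(1-xq^{r-1})$, ${m\brack r}_q=\frac{(q^{m-r+1};q)_r}{(q;q)_r}$, and entries with negative lower index are $0$. Let $G_q=\left({i\brack 2i-2j}_q\,q^{(i-j-1)(i-j)}\right)_{i,j\geq 1}$ (lower unitriangular) and $G_q^{ -1}=((-1)^{i-j}c_{i,j}(q))_{i,j\geq 1}$. The $q$-Seidel triangle $(g_{i,j}(q))$ is defined by $g_{1,1}(q)=g_{2,1}(q)=1$, $g_{i,j}(q)=0$ if $j<0$ or $j>\lceil i/2\rceil$, and for $i\geq1$: $g_{2i+1,j}(q)=g_{2i+1,j-1}(q)+q^{j-1}g_{2i,j}(q)$ for $j=1,\ldots,i+1$ (in this order), $g_{2i,j}(q)=g_{2i,j+1}(q)+q^{j-1}g_{2i-1,j}(q)$ for $j=i,\ldots,1$ (in this order). Then $G_2(q)=1$ and $G_{2n}(q)=g_{2n-1,n}(q)$ for $n\geq 2$. -}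

module Defs where

open import Level using (Level)
open import Data.Nat using (ℕ; zero; suc; _∸_; _≤ᵇ_; _≡ᵇ_) renaming (_*_ to _*ℕ_; _+_ to _+ℕ_)
open import Data.Bool using (if_then_else_)
open import Algebra.Bundles using (CommutativeRing)

-- The polynomial identity in ℤ[q] is the instance R = ℤ[q], q = the variable;
-- conversely the statement for every (R , q) follows from the one in ℤ[q].
module _ {c ℓ : Level} (R : CommutativeRing c ℓ) where
  open CommutativeRing R

  pow : Carrier → ℕ → Carrier
  pow x zero    = 1#
  pow x (suc n) = x * pow x n

  sumTo : ℕ → (ℕ → Carrier) → Carrier
  sumTo zero    f = 0#
  sumTo (suc n) f = sumTo n f + f (suc n)

  δ : ℕ → ℕ → Carrier
  δ i j = if i ≡ᵇ j then 1# else 0#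

  module _ (q : Carrier) where

    qbinom : ℕ → ℕ → Carrier
    qbinom zero    zero    = 1#
    qbinom zero    (suc r) = 0#
    qbinom (suc m) zero    = 1#
    qbinom (suc m) (suc r) = qbinom m r + pow q (suc r) * qbinom m (suc r)

    -- The matrix G_q (1-based indices i, j ≥ 1):
    -- entry [i, 2i-2j]_q q^((i-j-1)(i-j)), which is 0 when j > i
    -- (negative lower index).
    Gq : ℕ → ℕ → Carrier
    Gq i j = if j ≤ᵇ i
             then qbinom i (2 *ℕ (i ∸ j)) * pow q (((i ∸ j) ∸ 1) *ℕ (i ∸ j))
             else 0#

    -- q-Seidel triangle.  Rows are functions ℕ → Carrier of the column j;
    -- entries with j = 0 or j > ⌈i/2⌉ are 0.

    -- Row 2(i+1) from row 2i+1 (prev):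
    --   g_{2i+2, j} = g_{2i+2, j+1} + q^(j-1) g_{2i+1, j},  j = i+1, …, 1,
    --   with g_{2i+2, i+2} = 0.
    -- evenFrom i prev k = g_{2i+2, (i+1) - k}, for k = 0 .. i.
    evenFrom : ℕ → (ℕ → Carrier) → ℕ → Carrier
    evenFrom i prev zero    = 0# + pow q i * prev (suc i)
    evenFrom i prev (suc k) = evenFrom i prev k + pow q (i ∸ suc k) * prev (suc i ∸ suc k)

    evenRow : ℕ → (ℕ → Carrier) → ℕ → Carrier
    evenRow i prev zero    = 0#
    evenRow i prev (suc j) = if suc j ≤ᵇ suc i then evenFrom i prev (suc i ∸ suc j) else 0#

    -- Row 2i+3 from row 2i+2 (prev):
    --   g_{2i+3, j} = g_{2i+3, j-1} + q^(j-1) g_{2i+2, j},  j = 1, …, i+2,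
    --   with g_{2i+3, 0} = 0.
    oddUp : (ℕ → Carrier) → ℕ → Carrier
    oddUp prev zero    = 0#
    oddUp prev (suc j) = oddUp prev j + pow q j * prev (suc j)

    oddRow : ℕ → (ℕ → Carrier) → ℕ → Carrier
    oddRow i prev j = if j ≤ᵇ suc (suc i) then oddUp prev j else 0#

    -- rowOdd i = row 2i+1 of the triangle (g_{1,1} = 1).
    rowOdd : ℕ → ℕ → Carrier
    rowOdd zero    j = if j ≡ᵇ 1 then 1# else 0#
    rowOdd (suc i) = oddRow i (evenRow i (rowOdd i))

    -- G_2 = 1 and G_{2n} = g_{2n-1, n} = rowOdd (n-1) n for n ≥ 2.
    G2n : ℕ → Carrier
    G2n zero                = 0#
    G2n (suc zero)          = 1#
    G2n (suc (suc m))       = rowOdd (suc m) (suc (suc m))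

{-# OPTIONS --safe #-}
-- Put a_k = G_{2k}. Every entry of the q-Seidel triangle is a fixed q-binomial
-- combination of a_1, ..., a_r: the two Seidel recurrences are matched term by term
-- by the q-Pascal rule, so the closed form propagates along each row from its diagonal
-- end, where it reduces to a_r or to 0. Since the odd rows start from g_{2r+1,0} = 0,
-- the closed form vanishes at column 0, and that is exactly the identity
-- sum_k (-1)^(n-k) (G_q)_{n,k} a_k = 0 for n >= 2. Hence ((-1)^(k-1) a_k)_k solves
-- G_q x = e_1, and as G_q is unitriangular it is the first column of G_q^{-1}.

module Submission where

open import Defs
open import Level using (Level)
open import Data.Nat using (ℕ; zero; suc; _≤_; _<_; _∸_; _≤ᵇ_; z≤n; s≤s)
  renaming (_+_ to _+ℕ_; _*_ to _*ℕ_)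
open import Algebra.Bundles using (CommutativeRing)
import Data.Nat.Properties as ℕ
open import Data.Nat.Tactic.RingSolver using (solve-∀)
open import Data.Bool using (true; false; if_then_else_)
open import Data.Empty using (⊥-elim)
open import Data.Sum using (inj₁; inj₂)
open import Relation.Binary.PropositionalEquality as ≡ using (_≡_; cong; cong₂; subst)
import Algebra.Properties.CommutativeSemigroup as CommutativeSemigroupProperties
import Algebra.Properties.Group as GroupProperties
import Algebra.Properties.Ring as RingProperties
import Algebra.Solver.Ring.NaturalCoefficients.Default as NaturalCoefficientsSolver
import Relation.Binary.Reasoning.Setoid as SetoidReasoning

if-≤ᵇ-true : ∀ {a} {A : Set a} {m n} {x y : A} → m ≤ n → (if m ≤ᵇ n then x else y) ≡ x
if-≤ᵇ-true {m = m} {n} m≤n with m ≤ᵇ n | ℕ.≤⇒≤ᵇ m≤n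
... | true | _ = ≡.refl

if-≤ᵇ-false : ∀ {a} {A : Set a} {m n} {x y : A} → n < m → (if m ≤ᵇ n then x else y) ≡ y
if-≤ᵇ-false {m = m} {n} n<m with m ≤ᵇ n | ℕ.≤ᵇ⇒≤ m n
... | false | _   = ≡.refl
... | true  | m≤n = ⊥-elim (ℕ.<⇒≱ n<m (m≤n _))

suc-∸ : ∀ {m n} → n ≤ m → suc m ∸ n ≡ suc (m ∸ n)
suc-∸ = ℕ.+-∸-assoc 1

downward-induction : ∀ {p} (P : ℕ → Set p) {n} → P n →
                     (∀ {j} → j < n → P (suc j) → P j) → ∀ {j} → j ≤ n → P j
downward-induction P {n} Pn step {j} j≤n = go (n ∸ j) (ℕ.m+[n∸m]≡n j≤n)
  where
  go : ∀ d {j} → j +ℕ d ≡ n → P j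
  go zero    {j} j+0≡n = subst P (≡.trans (≡.sym j+0≡n) (ℕ.+-identityʳ j)) Pn
  go (suc d) {j} j+d≡n = step (subst (j <_) j+d≡n (ℕ.m<m+n j (s≤s z≤n)))
                              (go d (≡.trans (≡.sym (ℕ.+-suc j d)) j+d≡n))

evenExp-suc : ∀ j m → suc (2 *ℕ m) +ℕ (suc (2 *ℕ m) *ℕ j +ℕ m *ℕ suc m)
                    ≡ suc (2 *ℕ m) *ℕ suc j +ℕ m *ℕ suc m
evenExp-suc = solve-∀

evenExp-to-odd : ∀ j m → j +ℕ (suc (2 *ℕ m) *ℕ j +ℕ m *ℕ suc m) ≡ 2 *ℕ j *ℕ suc m +ℕ m *ℕ suc m
evenExp-to-odd = solve-∀

oddExp-suc-suc : ∀ j m → suc (suc (2 *ℕ m)) +ℕ (2 *ℕ j *ℕ suc m +ℕ m *ℕ suc m)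
                       ≡ 2 *ℕ suc j *ℕ suc m +ℕ m *ℕ suc m
oddExp-suc-suc = solve-∀

oddExp-to-even : ∀ j m → j +ℕ (2 *ℕ suc j *ℕ m +ℕ (m ∸ 1) *ℕ m) ≡ suc (2 *ℕ m) *ℕ j +ℕ m *ℕ suc m
oddExp-to-even j zero    = at-zero j
  where
  at-zero : ∀ j → j +ℕ (2 *ℕ suc j *ℕ 0 +ℕ 0) ≡ suc (2 *ℕ 0) *ℕ j +ℕ 0
  at-zero = solve-∀
oddExp-to-even j (suc m) = at-suc j m
  where
  at-suc : ∀ j m → j +ℕ (2 *ℕ suc j *ℕ suc m +ℕ m *ℕ suc m)
                 ≡ suc (2 *ℕ suc m) *ℕ j +ℕ suc m *ℕ suc (suc m)
  at-suc = solve-∀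

module _ {c ℓ : Level} (R : CommutativeRing c ℓ) (q : CommutativeRing.Carrier R) where
  open CommutativeRing R using (Carrier; 0#; _+_; _*_)
  open ≡.≡-Reasoning

  evenRow-top : ∀ i (prev : ℕ → Carrier) → evenRow R q i prev (suc (suc i)) ≡ 0#
  evenRow-top i prev = if-≤ᵇ-false (ℕ.n<1+n (suc i))

  evenRow-below : ∀ i (prev : ℕ → Carrier) {j} → j ≤ i →
                  evenRow R q i prev (suc j) ≡ evenFrom R q i prev (i ∸ j)
  evenRow-below i prev j≤i = if-≤ᵇ-true (s≤s j≤i)

  evenRow-step : ∀ i (prev : ℕ → Carrier) {j} → j ≤ i →
    evenRow R q i prev (suc j) ≡ evenRow R q i prev (suc (suc j)) + pow R q j * prev (suc j)
  evenRow-step i prev {j} j≤i with ℕ.m≤n⇒m<n∨m≡n j≤i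
  ... | inj₁ j<i = begin
    evenRow R q i prev (suc j)
      ≡⟨ evenRow-below i prev j≤i ⟩
    evenFrom R q i prev (i ∸ j)
      ≡⟨ cong (evenFrom R q i prev) (suc-∸ j<i) ⟩
    evenFrom R q i prev (suc (i ∸ suc j))
      ≡⟨ cong₂ (λ e k → evenFrom R q i prev (i ∸ suc j) + pow R q e * prev k)
               (≡.trans (cong (i ∸_) (≡.sym (suc-∸ j<i))) (ℕ.m∸[m∸n]≡n j≤i))
               (ℕ.m∸[m∸n]≡n j<i) ⟩
    evenFrom R q i prev (i ∸ suc j) + pow R q j * prev (suc j)
      ≡⟨ cong (_+ pow R q j * prev (suc j)) (evenRow-below i prev j<i) ⟨
    evenRow R q i prev (suc (suc j)) + pow R q j * prev (suc j)
      ∎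
  ... | inj₂ ≡.refl = begin
    evenRow R q i prev (suc i)
      ≡⟨ evenRow-below i prev ℕ.≤-refl ⟩
    evenFrom R q i prev (i ∸ i)
      ≡⟨ cong (evenFrom R q i prev) (ℕ.n∸n≡0 i) ⟩
    0# + pow R q i * prev (suc i)
      ≡⟨ cong (_+ pow R q i * prev (suc i)) (evenRow-top i prev) ⟨
    evenRow R q i prev (suc (suc i)) + pow R q i * prev (suc i)
      ∎

  oddRow-below : ∀ i (prev : ℕ → Carrier) {j} → j ≤ suc (suc i) → oddRow R q i prev j ≡ oddUp R q prev j
  oddRow-below i prev = if-≤ᵇ-true

module _ {c ℓ : Level} (R : CommutativeRing c ℓ) where
  open CommutativeRing R
  open SetoidReasoning setoid
  open CommutativeSemigroupProperties +-commutativeSemigroup using (interchange; xy∙z≈xz∙y)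
  open GroupProperties +-group using (∙-cancelˡ; ∙-cancelʳ; ⁻¹-involutive)
  open RingProperties ring using (-1*x≈-x)
  open NaturalCoefficientsSolver commutativeSemiring using (solve; _:=_; _:+_; _:*_)

  pow-+ : ∀ x m n → pow R x (m +ℕ n) ≈ pow R x m * pow R x n
  pow-+ x zero    n = sym (*-identityˡ _)
  pow-+ x (suc m) n = trans (*-congˡ (pow-+ x m n)) (sym (*-assoc _ _ _))

  sign : ℕ → Carrier
  sign = pow R (- 1#)

  sign-sq : ∀ k → sign k * sign k ≈ 1#
  sign-sq zero    = *-identityˡ 1#
  sign-sq (suc k) = begin
    (- 1# * sign k) * (- 1# * sign k)
      ≈⟨ solve 2 (λ u s → ((u :* s) :* (u :* s)) := ((u :* u) :* (s :* s))) refl (- 1#) (sign k) ⟩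
    (- 1# * - 1#) * (sign k * sign k)
      ≈⟨ *-cong (trans (-1*x≈-x (- 1#)) (⁻¹-involutive 1#)) (sign-sq k) ⟩
    1# * 1#
      ≈⟨ *-identityˡ 1# ⟩
    1#
      ∎

  sign-cancel : ∀ k x → sign k * (sign k * x) ≈ x
  sign-cancel k x = trans (sym (*-assoc _ _ _)) (trans (*-congʳ (sign-sq k)) (*-identityˡ x))

  sign-flip : ∀ {k n} → k ≤ n → sign k ≈ sign n * sign (n ∸ k)
  sign-flip {k} {n} k≤n = begin
    sign k                                    ≈⟨ sym (sign-cancel (n ∸ k) (sign k)) ⟩
    sign (n ∸ k) * (sign (n ∸ k) * sign k)    ≈⟨ *-congˡ (*-comm _ _) ⟩
    sign (n ∸ k) * (sign k * sign (n ∸ k))    ≈⟨ *-congˡ (sym (pow-+ (- 1#) k (n ∸ k))) ⟩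
    sign (n ∸ k) * sign (k +ℕ (n ∸ k))        ≡⟨ cong (λ e → sign (n ∸ k) * sign e) (ℕ.m+[n∸m]≡n k≤n) ⟩
    sign (n ∸ k) * sign n                     ≈⟨ *-comm _ _ ⟩
    sign n * sign (n ∸ k)                     ∎

  -1*x+x≈0 : ∀ x → - 1# * x + x ≈ 0#
  -1*x+x≈0 x = trans (+-congʳ (-1*x≈-x x)) (-‿inverseˡ x)

  sumTo-cong : ∀ n {f g : ℕ → Carrier} → (∀ {k} → 1 ≤ k → k ≤ n → f k ≈ g k) →
               sumTo R n f ≈ sumTo R n g
  sumTo-cong zero    f≈g = refl
  sumTo-cong (suc n) f≈g =
    +-cong (sumTo-cong n (λ 1≤k k≤n → f≈g 1≤k (ℕ.m≤n⇒m≤1+n k≤n))) (f≈g (s≤s z≤n) ℕ.≤-refl)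

  sumTo-zero : ∀ n {f : ℕ → Carrier} → (∀ {k} → 1 ≤ k → k ≤ n → f k ≈ 0#) → sumTo R n f ≈ 0#
  sumTo-zero zero    f≈0 = refl
  sumTo-zero (suc n) f≈0 = trans
    (+-cong (sumTo-zero n (λ 1≤k k≤n → f≈0 1≤k (ℕ.m≤n⇒m≤1+n k≤n))) (f≈0 (s≤s z≤n) ℕ.≤-refl))
    (+-identityˡ 0#)

  sumTo-+ : ∀ n (f g : ℕ → Carrier) → sumTo R n (λ k → f k + g k) ≈ sumTo R n f + sumTo R n g
  sumTo-+ zero    f g = sym (+-identityˡ 0#)
  sumTo-+ (suc n) f g = trans (+-congʳ (sumTo-+ n f g)) (interchange _ _ _ _)

  sumTo-*ˡ : ∀ n x (f : ℕ → Carrier) → sumTo R n (λ k → x * f k) ≈ x * sumTo R n f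
  sumTo-*ˡ zero    x f = sym (zeroʳ x)
  sumTo-*ˡ (suc n) x f = trans (+-congʳ (sumTo-*ˡ n x f)) (sym (distribˡ x _ _))

  sumTo-linear : ∀ n w (f g h : ℕ → Carrier) →
                 sumTo R n (λ k → (f k + w * g k) * h k)
                   ≈ sumTo R n (λ k → f k * h k) + w * sumTo R n (λ k → g k * h k)
  sumTo-linear n w f g h = begin
    sumTo R n (λ k → (f k + w * g k) * h k)
      ≈⟨ sumTo-cong n (λ {k} _ _ → trans (distribʳ (h k) _ _) (+-congˡ (*-assoc w _ _))) ⟩
    sumTo R n (λ k → f k * h k + w * (g k * h k))
      ≈⟨ trans (sumTo-+ n _ _) (+-congˡ (sumTo-*ˡ n w _)) ⟩
    sumTo R n (λ k → f k * h k) + w * sumTo R n (λ k → g k * h k)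
      ∎

  unitriangular-injective : (L : ℕ → ℕ → Carrier) → (∀ n → L n n ≈ 1#) → (x y : ℕ → Carrier) →
    (∀ n → 1 ≤ n → sumTo R n (λ k → L n k * x k) ≈ sumTo R n (λ k → L n k * y k)) →
    ∀ n → 1 ≤ n → x n ≈ y n
  unitriangular-injective L diag x y Lx≈Ly n 1≤n = agree n 1≤n ℕ.≤-refl
    where
    agree : ∀ n {k} → 1 ≤ k → k ≤ n → x k ≈ y k
    agree zero    (s≤s _) ()
    agree (suc n) {k} 1≤k k≤1+n with ℕ.m≤n⇒m<n∨m≡n k≤1+n
    ... | inj₁ k<1+n = agree n 1≤k (ℕ.≤-pred k<1+n)
    ... | inj₂ ≡.refl = begin
      x k          ≈⟨ diag-* x ⟨
      L k k * x k  ≈⟨ ∙-cancelˡ _ _ _ (trans (Lx≈Ly k 1≤k) (+-congʳ (sym earlier))) ⟩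
      L k k * y k  ≈⟨ diag-* y ⟩
      y k          ∎
      where
      diag-* : ∀ z → L k k * z k ≈ z k
      diag-* z = trans (*-congʳ (diag k)) (*-identityˡ _)
      earlier : sumTo R n (λ i → L k i * x i) ≈ sumTo R n (λ i → L k i * y i)
      earlier = sumTo-cong n (λ 1≤i i≤n → *-congˡ (agree n 1≤i i≤n))

  module _ (q : Carrier) where

    q^_ : ℕ → Carrier
    q^_ = pow R q

    q^-+ : ∀ a b {c} → a +ℕ b ≡ c → q^ a * q^ b ≈ q^ c
    q^-+ a b a+b≡c = trans (sym (pow-+ q a b)) (reflexive (cong q^_ a+b≡c))

    qbinom-zero : ∀ N → qbinom R q N 0 ≈ 1#
    qbinom-zero zero    = refl
    qbinom-zero (suc N) = refl

    Gq-diagonal : ∀ n → Gq R q n n ≈ 1#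
    Gq-diagonal n = begin
      Gq R q n n
        ≡⟨ if-≤ᵇ-true (ℕ.≤-refl {n}) ⟩
      qbinom R q n (2 *ℕ (n ∸ n)) * q^ (((n ∸ n) ∸ 1) *ℕ (n ∸ n))
        ≡⟨ cong (λ d → qbinom R q n (2 *ℕ d) * q^ ((d ∸ 1) *ℕ d)) (ℕ.n∸n≡0 n) ⟩
      qbinom R q n 0 * 1#
        ≈⟨ trans (*-identityʳ _) (qbinom-zero n) ⟩
      1#
        ∎

    oddRowCoeff : ℕ → ℕ → ℕ → Carrier
    oddRowCoeff N j m = sign m * (qbinom R q N (2 *ℕ m) * q^ (2 *ℕ j *ℕ m +ℕ (m ∸ 1) *ℕ m))

    evenRowCoeff : ℕ → ℕ → ℕ → Carrier
    evenRowCoeff N j m = sign m * (qbinom R q N (suc (2 *ℕ m)) * q^ (suc (2 *ℕ m) *ℕ j +ℕ m *ℕ suc m))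

    oddRowCoeff-zero : ∀ N j → oddRowCoeff N j 0 ≈ 1#
    oddRowCoeff-zero N j = begin
      1# * (qbinom R q N 0 * q^ (2 *ℕ j *ℕ 0 +ℕ 0))
        ≡⟨ cong (λ e → 1# * (qbinom R q N 0 * q^ (e +ℕ 0))) (ℕ.*-zeroʳ (2 *ℕ j)) ⟩
      1# * (qbinom R q N 0 * 1#)
        ≈⟨ trans (*-identityˡ _) (trans (*-identityʳ _) (qbinom-zero N)) ⟩
      1#
        ∎

    oddRowCoeff-∸-self : ∀ N j r → oddRowCoeff N j (r ∸ r) ≈ 1#
    oddRowCoeff-∸-self N j r = trans (reflexive (cong (oddRowCoeff N j) (ℕ.n∸n≡0 r))) (oddRowCoeff-zero N j)

    oddRowCoeff-Gq : ∀ {n k} → k ≤ n → oddRowCoeff n 0 (n ∸ k) ≡ sign (n ∸ k) * Gq R q n k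
    oddRowCoeff-Gq {n} {k} k≤n = cong (sign (n ∸ k) *_) (≡.sym (if-≤ᵇ-true k≤n))

    evenRowCoeff-pascal : ∀ N j m →
      evenRowCoeff (suc N) j m ≈ evenRowCoeff N (suc j) m + q^ j * oddRowCoeff N (suc j) m
    evenRowCoeff-pascal N j m = begin
      s * ((b₀ + X * b₁) * q^ E)
        ≈⟨ solve 5 (λ s b₀ X b₁ Y → (s :* ((b₀ :+ X :* b₁) :* Y)) := (s :* (b₁ :* (X :* Y)) :+ s :* (b₀ :* Y)))
                 refl s b₀ X b₁ (q^ E) ⟩
      s * (b₁ * (X * q^ E)) + s * (b₀ * q^ E)
        ≈⟨ +-cong (*-congˡ (*-congˡ (q^-+ (suc (2 *ℕ m)) E (evenExp-suc j m))))
                  (*-congˡ (*-congˡ (sym (q^-+ j O (oddExp-to-even j m))))) ⟩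
      s * (b₁ * q^ E₁) + s * (b₀ * (q^ j * q^ O))
        ≈⟨ +-congˡ (solve 4 (λ s b₀ W V → (s :* (b₀ :* (W :* V))) := (W :* (s :* (b₀ :* V))))
                          refl s b₀ (q^ j) (q^ O)) ⟩
      s * (b₁ * q^ E₁) + q^ j * (s * (b₀ * q^ O))
        ∎
      where
      s = sign m
      b₀ = qbinom R q N (2 *ℕ m)
      b₁ = qbinom R q N (suc (2 *ℕ m))
      X = q^ (suc (2 *ℕ m))
      E = suc (2 *ℕ m) *ℕ j +ℕ m *ℕ suc m
      E₁ = suc (2 *ℕ m) *ℕ suc j +ℕ m *ℕ suc m
      O = 2 *ℕ suc j *ℕ m +ℕ (m ∸ 1) *ℕ m

    oddRowCoeff-pascal : ∀ N j m →
      oddRowCoeff N (suc j) (suc m) ≈ oddRowCoeff (suc N) j (suc m) + q^ j * evenRowCoeff N j m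
    oddRowCoeff-pascal N j m = sym (begin
      u * s * (qbinom R q (suc N) (2 *ℕ suc m) * q^ O) + q^ j * (s * (b₁ * q^ E))
        ≡⟨ cong (λ e → u * s * (qbinom R q (suc N) e * q^ O) + q^ j * (s * (b₁ * q^ E))) (ℕ.*-suc 2 m) ⟩
      u * s * ((b₁ + X * b₂) * q^ O) + q^ j * (s * (b₁ * q^ E))
        ≈⟨ +-congˡ (solve 4 (λ W s b₁ V → (W :* (s :* (b₁ :* V))) := (s :* (b₁ :* (W :* V))))
                          refl (q^ j) s b₁ (q^ E)) ⟩
      u * s * ((b₁ + X * b₂) * q^ O) + s * (b₁ * (q^ j * q^ E))
        ≈⟨ +-congˡ (*-congˡ (*-congˡ (q^-+ j E (evenExp-to-odd j m)))) ⟩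
      u * s * ((b₁ + X * b₂) * q^ O) + s * (b₁ * q^ O)
        ≈⟨ solve 6 (λ u s b₁ X b₂ Y → (u :* s :* ((b₁ :+ X :* b₂) :* Y) :+ s :* (b₁ :* Y))
                                 := (u :* s :* (b₂ :* (X :* Y)) :+ (u :* (s :* (b₁ :* Y)) :+ s :* (b₁ :* Y))))
                 refl u s b₁ X b₂ (q^ O) ⟩
      u * s * (b₂ * (X * q^ O)) + (u * (s * (b₁ * q^ O)) + s * (b₁ * q^ O))
        ≈⟨ +-cong (*-congˡ (*-congˡ (q^-+ (suc (suc (2 *ℕ m))) O (oddExp-suc-suc j m)))) (-1*x+x≈0 _) ⟩
      u * s * (b₂ * q^ O₁) + 0#
        ≈⟨ +-identityʳ _ ⟩
      u * s * (b₂ * q^ O₁)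
        ≡⟨ cong (λ e → u * s * (qbinom R q N e * q^ O₁)) (ℕ.*-suc 2 m) ⟨
      u * s * (qbinom R q N (2 *ℕ suc m) * q^ O₁)
        ∎)
      where
      u = - 1#
      s = sign m
      b₁ = qbinom R q N (suc (2 *ℕ m))
      b₂ = qbinom R q N (suc (suc (2 *ℕ m)))
      X = q^ (suc (suc (2 *ℕ m)))
      E = suc (2 *ℕ m) *ℕ j +ℕ m *ℕ suc m
      O = 2 *ℕ j *ℕ suc m +ℕ m *ℕ suc m
      O₁ = 2 *ℕ suc j *ℕ suc m +ℕ m *ℕ suc m

    -- oddRowSum r (r ∸ j) j is g_{2r-1,j} and evenRowSum r (r ∸ j) j is g_{2r,j+1}.
    oddRowSum : ℕ → ℕ → ℕ → Carrier
    oddRowSum r N j = sumTo R r (λ k → oddRowCoeff N j (r ∸ k) * G2n R q k)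

    evenRowSum : ℕ → ℕ → ℕ → Carrier
    evenRowSum r N j = sumTo R r (λ k → evenRowCoeff N j (r ∸ k) * G2n R q k)

    evenRowSum-pascal : ∀ r N j →
      evenRowSum r (suc N) j ≈ evenRowSum r N (suc j) + q^ j * oddRowSum r N (suc j)
    evenRowSum-pascal r N j = trans
      (sumTo-cong r (λ {k} _ _ → *-congʳ (evenRowCoeff-pascal N j (r ∸ k))))
      (sumTo-linear r (q^ j) (λ k → evenRowCoeff N (suc j) (r ∸ k)) (λ k → oddRowCoeff N (suc j) (r ∸ k))
                    (G2n R q))

    oddRowSum-pascal : ∀ r N j →
      oddRowSum (suc r) N (suc j) ≈ oddRowSum (suc r) (suc N) j + q^ j * evenRowSum r N j
    oddRowSum-pascal r N j = begin
      sumTo R r (λ k → oddRowCoeff N (suc j) (suc r ∸ k) * G k) + oddRowCoeff N (suc j) (r ∸ r) * G (suc r)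
        ≈⟨ +-cong (sumTo-cong r shift)
                  (*-congʳ (trans (oddRowCoeff-∸-self N (suc j) r) (sym (oddRowCoeff-∸-self (suc N) j r)))) ⟩
      sumTo R r (λ k → (oddRowCoeff (suc N) j (suc r ∸ k) + q^ j * evenRowCoeff N j (r ∸ k)) * G k)
        + oddRowCoeff (suc N) j (r ∸ r) * G (suc r)
        ≈⟨ +-congʳ (sumTo-linear r (q^ j) (λ k → oddRowCoeff (suc N) j (suc r ∸ k))
                                          (λ k → evenRowCoeff N j (r ∸ k)) G) ⟩
      (sumTo R r (λ k → oddRowCoeff (suc N) j (suc r ∸ k) * G k) + q^ j * evenRowSum r N j)
        + oddRowCoeff (suc N) j (r ∸ r) * G (suc r)
        ≈⟨ xy∙z≈xz∙y _ _ _ ⟩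
      oddRowSum (suc r) (suc N) j + q^ j * evenRowSum r N j
        ∎
      where
      G = G2n R q
      shift : ∀ {k} → 1 ≤ k → k ≤ r →
              oddRowCoeff N (suc j) (suc r ∸ k) * G k
                ≈ (oddRowCoeff (suc N) j (suc r ∸ k) + q^ j * evenRowCoeff N j (r ∸ k)) * G k
      shift {k} _ k≤r rewrite suc-∸ k≤r = *-congʳ (oddRowCoeff-pascal N j (r ∸ k))

    evenRowSum-empty : ∀ r j → evenRowSum r 0 j ≈ 0#
    evenRowSum-empty r j =
      sumTo-zero r (λ _ _ → trans (*-congʳ (trans (*-congˡ (zeroˡ _)) (zeroʳ _))) (zeroˡ _))

    oddRowSum-top : ∀ r j → oddRowSum (suc r) 0 j ≈ G2n R q (suc r)
    oddRowSum-top r j = begin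
      sumTo R r (λ k → oddRowCoeff 0 j (suc r ∸ k) * G2n R q k) + oddRowCoeff 0 j (r ∸ r) * G2n R q (suc r)
        ≈⟨ +-cong (sumTo-zero r vanish) (*-congʳ (oddRowCoeff-∸-self 0 j r)) ⟩
      0# + 1# * G2n R q (suc r)
        ≈⟨ trans (+-identityˡ _) (*-identityˡ _) ⟩
      G2n R q (suc r)
        ∎
      where
      vanish : ∀ {k} → 1 ≤ k → k ≤ r → oddRowCoeff 0 j (suc r ∸ k) * G2n R q k ≈ 0#
      vanish {k} _ k≤r rewrite suc-∸ k≤r = trans (*-congʳ (trans (*-congˡ (zeroˡ _)) (zeroʳ _))) (zeroˡ _)

    module NextRows (i : ℕ)
      (row-i : ∀ {j} → 1 ≤ j → j ≤ suc i → rowOdd R q i j ≈ oddRowSum (suc i) (suc i ∸ j) j) where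

      nextEvenRow : ℕ → Carrier
      nextEvenRow = evenRow R q i (rowOdd R q i)

      evenRow-closed : ∀ {j} → j ≤ suc i → nextEvenRow (suc j) ≈ evenRowSum (suc i) (suc i ∸ j) j
      evenRow-closed =
        downward-induction (λ j → nextEvenRow (suc j) ≈ evenRowSum (suc i) (suc i ∸ j) j) top step
        where
        top : nextEvenRow (suc (suc i)) ≈ evenRowSum (suc i) (i ∸ i) (suc i)
        top = begin
          nextEvenRow (suc (suc i))           ≡⟨ evenRow-top R q i (rowOdd R q i) ⟩
          0#                                  ≈⟨ evenRowSum-empty (suc i) (suc i) ⟨
          evenRowSum (suc i) 0 (suc i)        ≡⟨ cong (λ N → evenRowSum (suc i) N (suc i)) (ℕ.n∸n≡0 i) ⟨
          evenRowSum (suc i) (i ∸ i) (suc i)  ∎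
        step : ∀ {j} → j < suc i → nextEvenRow (suc (suc j)) ≈ evenRowSum (suc i) (i ∸ j) (suc j) →
               nextEvenRow (suc j) ≈ evenRowSum (suc i) (suc i ∸ j) j
        step {j} j<1+i ih = begin
          nextEvenRow (suc j)
            ≡⟨ evenRow-step R q i (rowOdd R q i) (ℕ.≤-pred j<1+i) ⟩
          nextEvenRow (suc (suc j)) + q^ j * rowOdd R q i (suc j)
            ≈⟨ +-cong ih (*-congˡ (row-i (s≤s z≤n) j<1+i)) ⟩
          evenRowSum (suc i) (i ∸ j) (suc j) + q^ j * oddRowSum (suc i) (i ∸ j) (suc j)
            ≈⟨ evenRowSum-pascal (suc i) (i ∸ j) j ⟨
          evenRowSum (suc i) (suc (i ∸ j)) j
            ≡⟨ cong (λ N → evenRowSum (suc i) N j) (suc-∸ (ℕ.≤-pred j<1+i)) ⟨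
          evenRowSum (suc i) (suc i ∸ j) j
            ∎

      oddUp-closed : ∀ {j} → j ≤ suc (suc i) →
                     oddUp R q nextEvenRow j ≈ oddRowSum (suc (suc i)) (suc (suc i) ∸ j) j
      oddUp-closed =
        downward-induction (λ j → oddUp R q nextEvenRow j ≈ oddRowSum (suc (suc i)) (suc (suc i) ∸ j) j)
                           top step
        where
        top : oddUp R q nextEvenRow (suc (suc i)) ≈ oddRowSum (suc (suc i)) (suc i ∸ suc i) (suc (suc i))
        top = begin
          oddUp R q nextEvenRow (suc (suc i))
            ≡⟨ oddRow-below R q i nextEvenRow (ℕ.≤-refl {suc (suc i)}) ⟨
          G2n R q (suc (suc i))
            ≈⟨ oddRowSum-top (suc i) (suc (suc i)) ⟨
          oddRowSum (suc (suc i)) 0 (suc (suc i))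
            ≡⟨ cong (λ N → oddRowSum (suc (suc i)) N (suc (suc i))) (ℕ.n∸n≡0 (suc i)) ⟨
          oddRowSum (suc (suc i)) (suc i ∸ suc i) (suc (suc i))
            ∎
        step : ∀ {j} → j < suc (suc i) →
               oddUp R q nextEvenRow (suc j) ≈ oddRowSum (suc (suc i)) (suc i ∸ j) (suc j) →
               oddUp R q nextEvenRow j ≈ oddRowSum (suc (suc i)) (suc (suc i) ∸ j) j
        step {j} j<2+i ih = ∙-cancelʳ (q^ j * nextEvenRow (suc j)) _ _ (begin
          oddUp R q nextEvenRow j + q^ j * nextEvenRow (suc j)
            ≈⟨ ih ⟩
          oddRowSum (suc (suc i)) (suc i ∸ j) (suc j)
            ≈⟨ oddRowSum-pascal (suc i) (suc i ∸ j) j ⟩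
          oddRowSum (suc (suc i)) (suc (suc i ∸ j)) j + q^ j * evenRowSum (suc i) (suc i ∸ j) j
            ≈⟨ +-cong (reflexive (cong (λ N → oddRowSum (suc (suc i)) N j) (≡.sym (suc-∸ (ℕ.≤-pred j<2+i)))))
                      (*-congˡ (sym (evenRow-closed (ℕ.≤-pred j<2+i)))) ⟩
          oddRowSum (suc (suc i)) (suc (suc i) ∸ j) j + q^ j * nextEvenRow (suc j)
            ∎)

    rowOdd-closed : ∀ i {j} → 1 ≤ j → j ≤ suc i → rowOdd R q i j ≈ oddRowSum (suc i) (suc i ∸ j) j
    rowOdd-closed zero    {suc zero}    _ _       =
      sym (trans (+-identityˡ _) (trans (*-identityʳ _) (oddRowCoeff-zero 0 1)))
    rowOdd-closed zero    {suc (suc j)} _ (s≤s ())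
    rowOdd-closed (suc i) {j}           _ j≤2+i   =
      trans (reflexive (oddRow-below R q i _ j≤2+i)) (NextRows.oddUp-closed i (rowOdd-closed i) j≤2+i)

    oddRowSum-column0 : ∀ i → oddRowSum (suc (suc i)) (suc (suc i)) 0 ≈ 0#
    oddRowSum-column0 i = sym (NextRows.oddUp-closed i (rowOdd-closed i) z≤n)

    signedG2n : ℕ → Carrier
    signedG2n k = sign (k ∸ 1) * G2n R q k

    Gq-signedG2n : ∀ n → 1 ≤ n → sumTo R n (λ k → Gq R q n k * signedG2n k) ≈ δ R n 1
    Gq-signedG2n (suc zero)    _ =
      trans (+-identityˡ _) (trans (*-cong (*-identityʳ 1#) (*-identityˡ 1#)) (*-identityˡ 1#))
    Gq-signedG2n (suc (suc n)) _ = begin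
      sumTo R N (λ k → Gq R q N k * signedG2n k)
        ≈⟨ sumTo-cong N regroup ⟩
      sumTo R N (λ k → sign (suc n) * (oddRowCoeff N 0 (N ∸ k) * G2n R q k))
        ≈⟨ sumTo-*ˡ N (sign (suc n)) (λ k → oddRowCoeff N 0 (N ∸ k) * G2n R q k) ⟩
      sign (suc n) * oddRowSum N N 0
        ≈⟨ trans (*-congˡ (oddRowSum-column0 n)) (zeroʳ _) ⟩
      0#
        ∎
      where
      N = suc (suc n)
      regroup : ∀ {k} → 1 ≤ k → k ≤ N →
                Gq R q N k * signedG2n k ≈ sign (suc n) * (oddRowCoeff N 0 (N ∸ k) * G2n R q k)
      regroup {suc k} _ k<N = begin
        Gq R q N (suc k) * (sign k * G2n R q (suc k))
          ≈⟨ *-congˡ (*-congʳ (sign-flip (ℕ.≤-pred k<N))) ⟩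
        Gq R q N (suc k) * (sign (suc n) * sign (suc n ∸ k) * G2n R q (suc k))
          ≈⟨ solve 4 (λ g a b x → (g :* (a :* b :* x)) := (a :* (b :* g :* x)))
                   refl (Gq R q N (suc k)) (sign (suc n)) (sign (suc n ∸ k)) (G2n R q (suc k)) ⟩
        sign (suc n) * (sign (suc n ∸ k) * Gq R q N (suc k) * G2n R q (suc k))
          ≡⟨ cong (λ a → sign (suc n) * (a * G2n R q (suc k))) (oddRowCoeff-Gq k<N) ⟨
        sign (suc n) * (oddRowCoeff N 0 (N ∸ suc k) * G2n R q (suc k))
          ∎

    inverse-firstColumn : (M : ℕ → ℕ → Carrier) →
      (∀ i j → 1 ≤ i → 1 ≤ j → sumTo R i (λ k → Gq R q i k * M k j) ≈ δ R i j) →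
      ∀ n → 1 ≤ n → M n 1 ≈ signedG2n n
    inverse-firstColumn M GM≈I = unitriangular-injective (Gq R q) Gq-diagonal (λ k → M k 1) signedG2n
      (λ n 1≤n → trans (GM≈I n 1 1≤n (s≤s z≤n)) (sym (Gq-signedG2n n 1≤n)))

corollary1 : ∀ {c ℓ : Level} (R : CommutativeRing c ℓ)
    (q : CommutativeRing.Carrier R)
    (M : ℕ → ℕ → CommutativeRing.Carrier R)
    → (∀ i j → 1 ≤ i → 1 ≤ j →
         CommutativeRing._≈_ R
           (sumTo R i (λ k → CommutativeRing._*_ R (Gq R q i k) (M k j)))
           (δ R i j))
    → ∀ n → 1 ≤ n →
      CommutativeRing._≈_ R
        (CommutativeRing._*_ R (pow R (CommutativeRing.-_ R (CommutativeRing.1# R)) (n ∸ 1)) (M n 1))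
        (G2n R q n)
corollary1 R q M GM≈I n 1≤n =
  trans (*-congˡ (inverse-firstColumn R q M GM≈I n 1≤n)) (sign-cancel R (n ∸ 1) (G2n R q n))
  where
  open CommutativeRing R
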